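{- Let $\Pi$ be a finite set of proposition symbols and let $\varphi(x)$ be an $\mathrm{MSO}$-formula over $\Pi$ (with $x$ its only free variable) that is definable in $\omega\text{ - }\mathrm{GML}$. Then for every rooted tree $(T,w)$ over $\Pi$: if $T \models \varphi(w)$, then there is $k \in \mathbb N$ such that $(T,w)$ is $k$-extendable with respect to $\varphi(x)$, i.e., $T' \models \varphi(w)$ for every rooted tree $(T',w)$ whose $k$-prefix tree equals the $k$-prefix tree $(T_k,w)$ of $(T,w)$.
   Context: A Kripke model over $\Pi$ is $M=(W,R,V)$ with $R\subseteq W\times W$ and $V\colon W\to\mathcal P(\Pi)$; a pointed model is $(M,w)$ with $w\in W$; $v$ is a successor of $w$ if $(w,v)\in R$. A walk from $w$ to $v$ is a tuple $(v_1,\dots,v_{k+1})$ with $v_1=w$, $v_{k+1}=v$ and $(v_i,v_{i+1})\in R$; its length is $k$. A tree is a (possibly infinite) Kripke model with exactly one node $w$ (the root) having no $R$-predecessor and such that for every node $v$ there is exactly one walk from $w$ to $v$; a rooted tree is $(T,w)$ with $w$ the root of $T$. The $k$-prefix tree $(T_k,w)$ is the restriction of $T$ to the nodes reachable from $w$ by a path of length at most $k$. $\mathrm{MSO}$ is monadic second-order logic over the signature consisting of a unary predicate for each $p\in\Pi$ (interpreted by $V$) and the binary relation $R$. Graded modal logic $\mathrm{GML}$ has formulae $\varphi ::= p \mid \neg\varphi\mid \varphi\lor\varphi\mid \Diamond_{\ge k}\varphi$ ($p\in\Pi$, $k\in\mathbb N$), where $(M,w)\models\Diamond_{\ge k}\varphi$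 iff at least $k$ successors of $w$ satisfy $\varphi$. A formula of $\omega\text{ - }\mathrm{GML}$ is a $\mathrm{GML}$-formula or a disjunction $\bigvee_{\varphi\in S}\varphi$ over an at most countable set $S$ of $\mathrm{GML}$-formulae. An $\mathrm{MSO}$-formula $\varphi(x)$ is definable in $\omega\text{ - }\mathrm{GML}$ if there is an $\omega\text{ - }\mathrm{GML}$-formula $\psi$ with $M\models\varphi(w)\iff(M,w)\models\psi$ for all pointed models $(M,w)$. -}

module Defs where

open import Level using (Level) renaming (suc to lsuc; zero to lzero)
open import Data.Nat using (ℕ; zero; suc; _≤_; z≤n)
open import Data.Fin using (Fin)
open import Data.Bool using (Bool; true; false)
open import Data.Product using (Σ; _×_; _,_; ∃; ∃-syntax)
open import Data.Sum using (_⊎_)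
open import Data.Empty using (⊥)
open import Relation.Nullary using (¬_)
open import Relation.Binary.PropositionalEquality using (_≡_)
open import Function.Definitions using (Injective)
open import Function.Bundles using (_↣_; _↔_; _⇔_; Inverse)

-- Proposition symbols: Π = Fin n (a finite set of size n).
-- Subsets (of W, of Π) are represented by characteristic functions into Bool.

record Model (n : ℕ) : Set₁ where
  field
    W : Set
    R : W → W → Bool
    V : W → Fin n → Bool

open Model public

-- MSO over Π, with de Bruijn indices: m first-order, s second-order
-- (monadic) variables.

data MSO (n : ℕ) : ℕ → ℕ → Set where
  prop  : ∀ {m s} → Fin n → Fin m → MSO n m s
  rel   : ∀ {m s} → Fin m → Fin m → MSO n m s
  eq    : ∀ {m s} → Fin m → Fin m → MSO n m s
  mem   : ∀ {m s} → Fin s → Fin m → MSO n m s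
  neg   : ∀ {m s} → MSO n m s → MSO n m s
  or    : ∀ {m s} → MSO n m s → MSO n m s → MSO n m s
  ex1   : ∀ {m s} → MSO n (suc m) s → MSO n m s
  ex2   : ∀ {m s} → MSO n m (suc s) → MSO n m s

extend : {A : Set} {m : ℕ} → A → (Fin m → A) → Fin (suc m) → A
extend a ρ Fin.zero    = a
extend a ρ (Fin.suc i) = ρ i

msoSat : ∀ {n m s} (M : Model n) → MSO n m s →
         (Fin m → W M) → (Fin s → (W M → Bool)) → Set
msoSat M (prop p x) ρ σ = V M (ρ x) p ≡ true
msoSat M (rel x y)  ρ σ = R M (ρ x) (ρ y) ≡ true
msoSat M (eq x y)   ρ σ = ρ x ≡ ρ y
msoSat M (mem X x)  ρ σ = σ X (ρ x) ≡ true
msoSat M (neg φ)    ρ σ = ¬ msoSat M φ ρ σ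
msoSat M (or φ ψ)   ρ σ = msoSat M φ ρ σ ⊎ msoSat M ψ ρ σ
msoSat M (ex1 φ)    ρ σ = Σ (W M) λ a → msoSat M φ (extend a ρ) σ
msoSat M (ex2 φ)    ρ σ = Σ (W M → Bool) λ X → msoSat M φ ρ (extend X σ)

noSO : {A : Set} → Fin 0 → A
noSO ()

_⊨_at_ : ∀ {n} (M : Model n) → MSO n 1 0 → W M → Set
M ⊨ φ at w = msoSat M φ (λ _ → w) noSO

data GML (n : ℕ) : Set where
  prop : Fin n → GML n
  neg  : GML n → GML n
  or   : GML n → GML n → GML n
  dia≥ : ℕ → GML n → GML n

gmlSat : ∀ {n} (M : Model n) → W M → GML n → Set
gmlSat M w (prop p)   = V M w p ≡ true
gmlSat M w (neg φ)    = ¬ gmlSat M w φ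
gmlSat M w (or φ ψ)   = gmlSat M w φ ⊎ gmlSat M w ψ
gmlSat M w (dia≥ k φ) =
  Σ (Fin k → W M) λ f → Injective _≡_ _≡_ f ×
    ((i : Fin k) → (R M w (f i) ≡ true) × gmlSat M (f i) φ)

-- A disjunction over an at most countable set S of GML-formulae is given
-- by an index set I injecting into ℕ and a family I → GML.
data ωGML (n : ℕ) : Set₁ where
  gml : GML n → ωGML n
  ⋁   : (I : Set) → (I ↣ ℕ) → (I → GML n) → ωGML n

ωSat : ∀ {n} (M : Model n) → W M → ωGML n → Set
ωSat M w (gml φ)    = gmlSat M w φ
ωSat M w (⋁ I _ f)  = Σ I λ i → gmlSat M w (f i)

DefinableInωGML : ∀ {n} → MSO n 1 0 → Set₁
DefinableInωGML {n} φ =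
  Σ (ωGML n) λ ψ → (M : Model n) (w : W M) → (M ⊨ φ at w) ⇔ ωSat M w ψ

data Walk {n} (M : Model n) : W M → W M → ℕ → Set where
  here : ∀ {u} → Walk M u u zero
  step : ∀ {u v t k} → R M u v ≡ true → Walk M v t k → Walk M u t (suc k)

NoPredecessor : ∀ {n} (M : Model n) → W M → Set
NoPredecessor M w = (u : W M) → ¬ (R M u w ≡ true)

record IsRootedTree {n} (T : Model n) (w : W T) : Set where
  field
    rootNoPred   : NoPredecessor T w
    uniqueNoPred : (u : W T) → NoPredecessor T u → u ≡ w
    uniqueWalk   : (v : W T) →
      Σ (Σ ℕ (Walk T w v)) λ p → (q : Σ ℕ (Walk T w v)) → q ≡ p

restrict : ∀ {n} (M : Model n) → (W M → Set) → Model n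
restrict M P = record
  { W = Σ (W M) P
  ; R = λ { (u , _) (v , _) → R M u v }
  ; V = λ { (u , _) → V M u }
  }

Reach≤ : ∀ {n} (M : Model n) → ℕ → W M → W M → Set
Reach≤ M k w v = Σ ℕ λ m → (m ≤ k) × Walk M w v m

prefix : ∀ {n} (T : Model n) → W T → ℕ → Model n
prefix T w k = restrict T (Reach≤ T k w)

prefixRoot : ∀ {n} (T : Model n) (w : W T) (k : ℕ) → W (prefix T w k)
prefixRoot T w k = w , zero , z≤n , here

-- equality (up to renaming of nodes) of pointed models: an isomorphism
-- of Kripke models mapping the distinguished point to the distinguished point
record PointedIso {n} (M₁ : Model n) (w₁ : W M₁) (M₂ : Model n) (w₂ : W M₂) : Set where
  field
    iso  : W M₁ ↔ W M₂
  open Inverse iso public using (to)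
  field
    root : to w₁ ≡ w₂
    relR : (u v : W M₁) → R M₁ u v ≡ R M₂ (to u) (to v)
    valV : (u : W M₁) (p : Fin n) → V M₁ u p ≡ V M₂ (to u) p

Extendable : ∀ {n} → MSO n 1 0 → (T : Model n) → W T → ℕ → Set₁
Extendable {n} φ T w k =
  (T' : Model n) (w' : W T') → IsRootedTree T' w' →
  PointedIso (prefix T' w' k) (prefixRoot T' w' k) (prefix T w k) (prefixRoot T w k) →
  T' ⊨ φ at w'

-- A formula of ω-GML is a countable disjunction of GML formulae, so T ⊨ φ(w)
-- is witnessed by a single GML disjunct g holding at w; let k be its modal
-- depth. Truth of a GML formula of depth d at a node is invariant under
-- isomorphism and under restriction to any submodel containing everything
-- reachable in at most d steps, provided membership in the submodel is
-- proof-irrelevant; in a tree, where walks are unique, the prefix is such a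
-- submodel. Hence g holds at the root of the k-prefix tree of T, hence at
-- the root of the k-prefix tree of any T' with an isomorphic k-prefix, hence
-- at the root of T', and then so does the disjunction and thus φ.
module Submission where

open import Defs
open import Data.Nat using (ℕ; zero; suc; _+_; _≤_; s≤s; _⊔_)
open import Data.Nat.Properties using (≤-irrelevant; ≤-refl; ≤-trans; +-suc; m≤m+n; m≤m⊔n; m≤n⊔m)
open import Data.Bool using (true)
open import Data.Unit using (⊤; tt)
open import Data.Product using (Σ; _×_; _,_; proj₁; proj₂)
open import Data.Sum.Function.Propositional using (_⊎-⇔_)
open import Function using (_∘_)
open import Function.Bundles using (_⇔_; mk⇔; Inverse; Injection; Equivalence)
open import Function.Properties.Inverse using (↔⇒↣)
open import Function.Related.TypeIsomorphisms using (¬-cong-⇔)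
open import Relation.Unary using (Irrelevant)
open import Relation.Binary.PropositionalEquality using (_≡_; refl; sym; trans; cong; subst)

modalDepth : ∀ {n} → GML n → ℕ
modalDepth (prop _)   = 0
modalDepth (neg g)    = modalDepth g
modalDepth (or g h)   = modalDepth g ⊔ modalDepth h
modalDepth (dia≥ _ g) = suc (modalDepth g)

_∷ʳ_ : ∀ {n} {M : Model n} {u v t m} → Walk M u v m → R M v t ≡ true → Walk M u t (suc m)
here       ∷ʳ e = step e here
step e′ wk ∷ʳ e = step e′ (wk ∷ʳ e)

module _ {n} {M₁ M₂ : Model n} {w₁ : W M₁} {w₂ : W M₂} (π : PointedIso M₁ w₁ M₂ w₂) where
  open PointedIso π
  open Inverse iso using (from; strictlyInverseˡ)

  gmlSat-iso : (g : GML n) (u : W M₁) → gmlSat M₁ u g ⇔ gmlSat M₂ (to u) g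
  gmlSat-iso (prop p)   u = mk⇔ (trans (sym (valV u p))) (trans (valV u p))
  gmlSat-iso (neg g)    u = ¬-cong-⇔ (gmlSat-iso g u)
  gmlSat-iso (or g h)   u = gmlSat-iso g u ⊎-⇔ gmlSat-iso h u
  gmlSat-iso (dia≥ j g) u = mk⇔ forth back
    where
      forth : gmlSat M₁ u (dia≥ j g) → gmlSat M₂ (to u) (dia≥ j g)
      forth (f , f-inj , f-sat) =
        to ∘ f ,
        f-inj ∘ Injection.injective (↔⇒↣ iso) ,
        λ i → trans (sym (relR u (f i))) (proj₁ (f-sat i)) ,
              Equivalence.to (gmlSat-iso g (f i)) (proj₂ (f-sat i))

      back : gmlSat M₂ (to u) (dia≥ j g) → gmlSat M₁ u (dia≥ j g)
      back (f , f-inj , f-sat) =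
        from ∘ f ,
        (λ {i} {i′} e → f-inj (trans (sym (strictlyInverseˡ (f i)))
                                (trans (cong to e) (strictlyInverseˡ (f i′))))) ,
        λ i → let f≡to∘from∘f = sym (strictlyInverseˡ (f i)) in
              trans (relR u (from (f i)))
                    (subst (λ v → R M₂ (to u) v ≡ true) f≡to∘from∘f (proj₁ (f-sat i))) ,
              Equivalence.from (gmlSat-iso g (from (f i)))
                    (subst (λ v → gmlSat M₂ v g) f≡to∘from∘f (proj₂ (f-sat i)))

module _ {n} (M : Model n) (P : W M → Set) where

  SuccessorsIn : ℕ → W M → Set
  SuccessorsIn zero    u = ⊤
  SuccessorsIn (suc d) u = (v : W M) → R M u v ≡ true → P v × SuccessorsIn d v

  -- Irrelevance of P makes the projection from the restriction injective,
  -- which is what keeps graded counts intact.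
  gmlSat-restrict : Irrelevant P → (g : GML n) (d : ℕ) → modalDepth g ≤ d →
                    (u : W M) (p : P u) → SuccessorsIn d u →
                    gmlSat M u g ⇔ gmlSat (restrict M P) (u , p) g
  gmlSat-restrict P-irr (prop _)   d g≤d u p succ = mk⇔ (λ x → x) (λ x → x)
  gmlSat-restrict P-irr (neg g)    d g≤d u p succ = ¬-cong-⇔ (gmlSat-restrict P-irr g d g≤d u p succ)
  gmlSat-restrict P-irr (or g h)   d g⊔h≤d u p succ =
    gmlSat-restrict P-irr g d (≤-trans (m≤m⊔n _ _) g⊔h≤d) u p succ ⊎-⇔
    gmlSat-restrict P-irr h d (≤-trans (m≤n⊔m _ _) g⊔h≤d) u p succ
  gmlSat-restrict P-irr (dia≥ j g) (suc d) (s≤s g≤d) u p succ = mk⇔ forth back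
    where
      sub : ∀ v (p : P v) → R M u v ≡ true → gmlSat M v g ⇔ gmlSat (restrict M P) (v , p) g
      sub v p e = gmlSat-restrict P-irr g d g≤d v p (proj₂ (succ v e))

      forth : gmlSat M u (dia≥ j g) → gmlSat (restrict M P) (u , p) (dia≥ j g)
      forth (f , f-inj , f-sat) =
        (λ i → f i , proj₁ (succ (f i) (proj₁ (f-sat i)))) ,
        f-inj ∘ cong proj₁ ,
        λ i → proj₁ (f-sat i) ,
              Equivalence.to (sub (f i) _ (proj₁ (f-sat i))) (proj₂ (f-sat i))

      back : gmlSat (restrict M P) (u , p) (dia≥ j g) → gmlSat M u (dia≥ j g)
      back (f , f-inj , f-sat) =
        proj₁ ∘ f ,
        (λ {i} {i′} e → f-inj (Σ-≡ e)) ,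
        λ i → proj₁ (f-sat i) ,
              Equivalence.from (sub (proj₁ (f i)) (proj₂ (f i)) (proj₁ (f-sat i))) (proj₂ (f-sat i))
        where
          Σ-≡ : {a b : Σ (W M) P} → proj₁ a ≡ proj₁ b → a ≡ b
          Σ-≡ {v , p} {.v , q} refl = cong (v ,_) (P-irr p q)

Walk⇒SuccessorsIn-Reach≤ : ∀ {n} {T : Model n} {w k m u} (d : ℕ) → m + d ≤ k → Walk T w u m →
                           SuccessorsIn T (Reach≤ T k w) d u
Walk⇒SuccessorsIn-Reach≤             zero    m+d≤k wk = tt
Walk⇒SuccessorsIn-Reach≤ {k = k} {m} (suc d) m+d≤k wk v e =
  (suc m , ≤-trans (s≤s (m≤m+n m d)) 1+m+d≤k , wk ∷ʳ e) ,
  Walk⇒SuccessorsIn-Reach≤ d 1+m+d≤k (wk ∷ʳ e)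
  where
    1+m+d≤k : suc (m + d) ≤ k
    1+m+d≤k = subst (_≤ k) (+-suc m d) m+d≤k

module _ {n} {T : Model n} {w : W T} (tree : IsRootedTree T w) where
  open IsRootedTree tree

  Reach≤-irrelevant : (k : ℕ) → Irrelevant (Reach≤ T k w)
  Reach≤-irrelevant k {u} (m , m≤k , wk) (m′ , m′≤k , wk′)
    with trans (proj₂ (uniqueWalk u) (m , wk)) (sym (proj₂ (uniqueWalk u) (m′ , wk′)))
  ... | refl = cong (λ m≤k → m , m≤k , wk) (≤-irrelevant m≤k m′≤k)

  gmlSat-prefix : (k : ℕ) (g : GML n) → modalDepth g ≤ k →
                  gmlSat T w g ⇔ gmlSat (prefix T w k) (prefixRoot T w k) g
  gmlSat-prefix k g g≤k =
    gmlSat-restrict T (Reach≤ T k w) (Reach≤-irrelevant k) g k g≤k w _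
                    (Walk⇒SuccessorsIn-Reach≤ k ≤-refl here)

ωSat⇒gmlDisjunct : ∀ {n} (M : Model n) (w : W M) (ψ : ωGML n) → ωSat M w ψ →
                   Σ (GML n) λ g → gmlSat M w g ×
                     ((M′ : Model n) (w′ : W M′) → gmlSat M′ w′ g → ωSat M′ w′ ψ)
ωSat⇒gmlDisjunct M w (gml g)   sat     = g   , sat , λ _ _ sat′ → sat′
ωSat⇒gmlDisjunct M w (⋁ I _ f) (i , sat) = f i , sat , λ _ _ sat′ → i , sat′

proposition1 : {n : ℕ} (φ : MSO n 1 0) → DefinableInωGML φ →
    (T : Model n) (w : W T) → IsRootedTree T w → T ⊨ φ at w →
    Σ ℕ (Extendable φ T w)
proposition1 φ (ψ , φ⇔ψ) T w tree T⊨φ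
  with ωSat⇒gmlDisjunct T w ψ (Equivalence.to (φ⇔ψ T w) T⊨φ)
... | g , T⊨g , g⇒ψ = modalDepth g , extendable
  where
    k = modalDepth g

    extendable : Extendable φ T w k
    extendable T′ w′ tree′ π = Equivalence.from (φ⇔ψ T′ w′) (g⇒ψ T′ w′ T′⊨g)
      where
        Tₖ⊨g : gmlSat (prefix T w k) (prefixRoot T w k) g
        Tₖ⊨g = Equivalence.to (gmlSat-prefix tree k g ≤-refl) T⊨g

        T′ₖ⊨g : gmlSat (prefix T′ w′ k) (prefixRoot T′ w′ k) g
        T′ₖ⊨g = Equivalence.from (gmlSat-iso π g (prefixRoot T′ w′ k))
                  (subst (λ v → gmlSat (prefix T w k) v g) (sym (PointedIso.root π)) Tₖ⊨g)

        T′⊨g : gmlSat T′ w′ g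
        T′⊨g = Equivalence.from (gmlSat-prefix tree′ k g ≤-refl) T′ₖ⊨g
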